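{- For every $n\ge 1$ and $i\in\{1,2\}$, $s_i(n,\# P_6,S_4)=0$.
   Context: For graphs $F$ and $H$, the $F$-saturation game on $n$ vertices is played by Max and Mini, who alternately claim previously unclaimed edges of $K_n$ so that the graph $G$ of claimed edges stays $F$-free; the game ends when $G$ is $F$-saturated. The $H$-score is the number of (not necessarily induced) subgraphs of the final $G$ isomorphic to $H$. Max maximizes, Mini minimizes the score; $s_1(n,\# H,F)$ is the optimal score when Max starts, $s_2(n,\# H,F)$ when Mini starts. $P_6$ is the path on 6 vertices and $S_4$ the star on 4 vertices. -}

module Defs where

open import Data.Bool using (Bool; true; false; _∧_; _∨_; not; if_then_else_)
open import Data.Nat using (ℕ; zero; suc; _⊔_; _⊓_; _<ᵇ_; _≡ᵇ_)
open import Data.Nat.DivMod using (_/_)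
open import Data.Fin using (Fin; toℕ; _≟_; zero; suc)
open import Data.Vec using (Vec; []; _∷_; lookup)
open import Data.List using (List; []; _∷_; [_]; map; concatMap; filter; length; allFin; foldr; cartesianProduct)
open import Data.Bool.ListAction using (all; any)
open import Data.Product using (_×_; _,_; proj₁; proj₂)
open import Relation.Nullary using (does)
open import Relation.Nullary.Decidable using (T?)

-- Simple graphs on vertex set Fin n, as symmetric Boolean adjacency
-- functions (all graphs built below are symmetric and loopless).

Graph : ℕ → Set
Graph n = Fin n → Fin n → Bool

emptyGraph : ∀ {n} → Graph n
emptyGraph _ _ = false

_==ᶠ_ : ∀ {n} → Fin n → Fin n → Bool
a ==ᶠ b = does (a ≟ b)

addEdge : ∀ {n} → Graph n → Fin n × Fin n → Graph n
addEdge G (i , j) x y = G x y ∨ ((x ==ᶠ i ∧ y ==ᶠ j) ∨ (x ==ᶠ j ∧ y ==ᶠ i))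

record Pattern : Set where
  field
    k     : ℕ
    edges : List (Fin k × Fin k)
open Pattern public

patternGraph : (H : Pattern) → Graph (k H)
patternGraph H x y =
  any (λ e → (proj₁ e ==ᶠ x ∧ proj₂ e ==ᶠ y) ∨ (proj₁ e ==ᶠ y ∧ proj₂ e ==ᶠ x)) (edges H)

allVecs : (k n : ℕ) → List (Vec (Fin n) k)
allVecs zero    n = [ [] ]
allVecs (suc k) n = concatMap (λ v → map (_∷ v) (allFin n)) (allVecs k n)

injectiveᵇ : ∀ {k n} → Vec (Fin n) k → Bool
injectiveᵇ {k} v =
  all (λ p → (proj₁ p ==ᶠ proj₂ p) ∨ not (lookup v (proj₁ p) ==ᶠ lookup v (proj₂ p)))
      (cartesianProduct (allFin k) (allFin k))

-- v is an injective homomorphism (embedding as a not necessarily induced subgraph)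
embeddingᵇ : ∀ {n} (H : Pattern) → Graph n → Vec (Fin n) (k H) → Bool
embeddingᵇ H G v =
  injectiveᵇ v ∧ all (λ e → G (lookup v (proj₁ e)) (lookup v (proj₂ e))) (edges H)

#emb : ∀ {n} (H : Pattern) → Graph n → ℕ
#emb {n} H G = length (filter (λ v → T? (embeddingᵇ H G v)) (allVecs (k H) n))

-- division returning 0 for divisor 0 (never used with divisor 0:
-- the identity is an embedding of H into itself)
_div_ : ℕ → ℕ → ℕ
m div zero  = 0
m div suc d = m / suc d

-- number of (not necessarily induced) subgraphs of G isomorphic to H
-- = #(injective homs H → G) / |Aut H|, with |Aut H| = #(injective homs H → H)
#copies : ∀ {n} (H : Pattern) → Graph n → ℕ
#copies H G = #emb H G div #emb H (patternGraph H)

free : ∀ {n} (F : Pattern) → Graph n → Bool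
free F G = #emb F G ≡ᵇ 0

data Player : Set where
  Max Mini : Player

edgesKn : (n : ℕ) → List (Fin n × Fin n)
edgesKn n = filter (λ p → T? (toℕ (proj₁ p) <ᵇ toℕ (proj₂ p)))
                   (cartesianProduct (allFin n) (allFin n))

-- legal moves: unclaimed edges whose addition keeps G F-free.
-- The game is over (G is F-saturated) exactly when this list is empty.
legalMoves : ∀ {n} (F : Pattern) → Graph n → List (Fin n × Fin n)
legalMoves {n} F G =
  filter (λ e → T? (not (G (proj₁ e) (proj₂ e)) ∧ free F (addEdge G e))) (edgesKn n)

maxList : ℕ → List ℕ → ℕ
maxList = foldr _⊔_

minList : ℕ → List ℕ → ℕ
minList = foldr _⊓_

-- The fuel counts remaining moves; every move claims a new edge of K_n,
-- so fuel = |E(K_n)| is never exhausted before the game ends.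
mutual
  value : ∀ {n} (H F : Pattern) → ℕ → Player → Graph n → ℕ
  value H F fuel p G = step H F fuel p G (legalMoves F G)

  step : ∀ {n} (H F : Pattern) → ℕ → Player → Graph n → List (Fin n × Fin n) → ℕ
  step H F fuel     p    G []       = #copies H G
  step H F zero     p    G (_ ∷ _)  = #copies H G
  step H F (suc f)  Max  G (m ∷ ms) =
    maxList (value H F f Mini (addEdge G m)) (map (λ e → value H F f Mini (addEdge G e)) ms)
  step H F (suc f)  Mini G (m ∷ ms) =
    minList (value H F f Max (addEdge G m)) (map (λ e → value H F f Max (addEdge G e)) ms)

s₁ : ℕ → Pattern → Pattern → ℕ
s₁ n H F = value {n} H F (length (edgesKn n)) Max emptyGraph

s₂ : ℕ → Pattern → Pattern → ℕ
s₂ n H F = value {n} H F (length (edgesKn n)) Mini emptyGraph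

fin : {m : ℕ} → ℕ → Fin (suc m)
fin {m} zero = zero
fin {zero} (suc i) = zero
fin {suc m} (suc i) = suc (fin {m} i)

P₆ : Pattern
P₆ = record { k = 6 ; edges = (fin 0 , fin 1) ∷ (fin 1 , fin 2) ∷ (fin 2 , fin 3) ∷ (fin 3 , fin 4) ∷ (fin 4 , fin 5) ∷ [] }

S₄ : Pattern
S₄ = record { k = 4 ; edges = (fin 0 , fin 1) ∷ (fin 0 , fin 2) ∷ (fin 0 , fin 3) ∷ [] }

-- Claimed graphs are S₄-free, i.e. have maximum degree at most 2, so a copy of P₆ needs a component with
-- at least six vertices; Mini keeps all components smaller.  Whenever Max is to move, the graph consists
-- of isolated vertices, cycles of length at most 5 and at most one path, which has at most 4 vertices.
-- A legal move joins two vertices of degree at most 1, so Max starts a new path, extends the path by an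
-- isolated vertex, or closes it into a cycle.  Mini restores the invariant by closing the old or the
-- extended path (of 3 to 5 vertices) into a cycle, by joining two single edges into a path on 4 vertices,
-- by extending a lone single edge, or, if no path is left, by starting a new one.  The vertices of a
-- cycle have degree 2 and are never touched again, so every component of the final graph has at most
-- five vertices and its P₆-score is 0.
module Submission where

open import Defs
open import Data.Bool using (Bool; true; false; T; not; _∧_; _∨_)
open import Data.Bool.Properties using (T-∧; T-∨)
open import Data.Bool.ListAction using (all)
open import Data.Empty using (⊥-elim)
open import Data.Fin using (Fin; zero; suc; _≟_; toℕ)
open import Data.Fin.Properties using (pigeonhole; <⇒≢; suc-injective; toℕ-injective)
open import Data.List using (List; []; _∷_; length; allFin; cartesianProduct; map)
import Data.List as List
open import Data.List.Membership.Propositional using (_∈_; _∉_; lose)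
open import Data.List.Membership.Propositional.Properties
  using (∈-filter⁺; ∈-filter⁻; ∈-cartesianProduct⁺; ∈-allFin; ∈-concatMap⁺; ∈-map⁺)
open import Data.List.Properties using (filter-none; foldr-preservesᵇ; foldr-preservesᵒ)
open import Data.List.Relation.Unary.All using (universal; tabulate)
import Data.List.Relation.Unary.All.Properties as All
open import Data.List.Relation.Unary.Any using (Any; here; there)
import Data.List.Relation.Unary.Any as Any
import Data.List.Relation.Unary.Any.Properties as Any
open import Data.List.Relation.Unary.Any.Properties using (lookup-index)
open import Data.Nat using (ℕ; zero; suc; _<ᵇ_; _≥_; _≤_; _<_; _⊓_; z≤n; s≤s)
open import Data.Nat.Properties
  using (≤-refl; ≤-reflexive; ≤-trans; n≤0⇒n≡0; ≡ᵇ⇒≡; ≡⇒≡ᵇ; <ᵇ⇒<; <⇒<ᵇ; <-irrefl; <-cmp)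
open import Data.Nat.Properties using (⊔-lub; m⊓n≤m; m⊓n≤n)
open import Data.Product using (∃; _×_; _,_; proj₁; proj₂)
import Data.Product as Product
open import Data.Sum using (_⊎_; inj₁; inj₂; [_,_]′)
import Data.Sum as Sum
open import Data.Unit using (⊤)
open import Data.Vec using (Vec; []; _∷_; lookup)
open import Data.Vec.Relation.Unary.All using ([]; _∷_)
open import Data.Vec.Relation.Unary.AllPairs using ([]; _∷_)
open import Data.Vec.Relation.Unary.Unique.Propositional using (Unique)
open import Data.Vec.Relation.Unary.Unique.Propositional.Properties using (lookup-injective)
open import Function.Base using (_∘_; case_of_)
open import Function.Bundles using (module Equivalence)
open import Relation.Binary.Definitions using (tri<; tri≈; tri>)
open import Relation.Binary.PropositionalEquality using (_≡_; _≢_; refl; cong; subst; sym; trans)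
open import Relation.Nullary using (¬_; yes; no; contradiction)
open import Relation.Nullary.Decidable using (T?)

open Equivalence using (to; from)

pattern ∈₀ = here refl
pattern ∈₁ = there ∈₀
pattern ∈₂ = there ∈₁
pattern ∈₃ = there ∈₂
pattern ∈₄ = there ∈₃

T-all⁻ : ∀ {A : Set} (p : A → Bool) {xs x} → T (all p xs) → x ∈ xs → T (p x)
T-all⁻ p {y ∷ _} h (here refl) = proj₁ (to T-∧ h)
T-all⁻ p {y ∷ _} h (there x∈xs) = T-all⁻ p (proj₂ (to (T-∧ {p y}) h)) x∈xs

T-all⁺ : ∀ {A : Set} (p : A → Bool) {xs} → (∀ {x} → x ∈ xs → T (p x)) → T (all p xs)
T-all⁺ p {[]} _ = _
T-all⁺ p {y ∷ _} h = from T-∧ (h (here refl) , T-all⁺ p (h ∘ there))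

T-not⇒¬T : ∀ {b} → T (not b) → ¬ T b
T-not⇒¬T {false} _ ()

¬T⇒T-not : ∀ {b} → ¬ T b → T (not b)
¬T⇒T-not {true} ¬t = ¬t _
¬T⇒T-not {false} _ = _

module _ {m : ℕ} {a b : Fin m} where

  T-==ᶠ⁻ : T (a ==ᶠ b) → a ≡ b
  T-==ᶠ⁻ h with a ≟ b
  ... | yes a≡b = a≡b

  T-==ᶠ⁺ : a ≡ b → T (a ==ᶠ b)
  T-==ᶠ⁺ a≡b with a ≟ b
  ... | yes _ = _
  ... | no a≢b = a≢b a≡b

  T-not-==ᶠ⁻ : T (not (a ==ᶠ b)) → a ≢ b
  T-not-==ᶠ⁻ h with a ≟ b
  ... | no a≢b = a≢b

  T-not-==ᶠ⁺ : a ≢ b → T (not (a ==ᶠ b))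
  T-not-==ᶠ⁺ a≢b with a ≟ b
  ... | yes a≡b = a≢b a≡b
  ... | no _ = _

covered⇒¬injective : ∀ {A : Set} {m k} (f : Fin m → A) (g : Fin k → A) → m < k →
                     (∀ i → ∃ λ j → f j ≡ g i) → ¬ (∀ i j → g i ≡ g j → i ≡ j)
covered⇒¬injective f g m<k cover inj with pigeonhole m<k (proj₁ ∘ cover)
... | i , j , i<j , same = <⇒≢ i<j (inj i j (trans (sym (proj₂ (cover i))) (trans (cong f same) (proj₂ (cover j)))))

maxList-≤ : ∀ {A : Set} (g : A → ℕ) {b} m ms → (∀ {e} → e ∈ m ∷ ms → g e ≤ b) →
            maxList (g m) (map g ms) ≤ b
maxList-≤ g {b} m ms ≤b =
  foldr-preservesᵇ {P = _≤ b} ⊔-lub (≤b (here refl)) (All.map⁺ (tabulate (≤b ∘ there)))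

minList-≤ : ∀ {A : Set} (g : A → ℕ) {b} m ms {e} → e ∈ m ∷ ms → g e ≤ b → minList (g m) (map g ms) ≤ b
minList-≤ g {b} m ms e∈ ge≤b = foldr-preservesᵒ {P = _≤ b} ⊓-≤ (g m) (map g ms) (witness e∈)
  where
  ⊓-≤ : ∀ x y → x ≤ b ⊎ y ≤ b → x ⊓ y ≤ b
  ⊓-≤ x y (inj₁ x≤b) = ≤-trans (m⊓n≤m x y) x≤b
  ⊓-≤ x y (inj₂ y≤b) = ≤-trans (m⊓n≤n x y) y≤b
  witness : _ ∈ m ∷ ms → g m ≤ b ⊎ Any (_≤ b) (map g ms)
  witness (here refl) = inj₁ ge≤b
  witness (there e∈ms) = inj₂ (Any.map⁺ (lose e∈ms ge≤b))

module _ {n : ℕ} where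

  injectiveᵇ⁻ : ∀ {k} (v : Vec (Fin n) k) → T (injectiveᵇ v) → ∀ i j → lookup v i ≡ lookup v j → i ≡ j
  injectiveᵇ⁻ {k} v h i j vi≡vj
    with to T-∨ (T-all⁻ _ h (∈-cartesianProduct⁺ (∈-allFin {n = k} i) (∈-allFin j)))
  ... | inj₁ i==j = T-==ᶠ⁻ i==j
  ... | inj₂ vi≠vj = contradiction vi≡vj (T-not-==ᶠ⁻ vi≠vj)

  injectiveᵇ⁺ : ∀ {k} (v : Vec (Fin n) k) → (∀ i j → lookup v i ≡ lookup v j → i ≡ j) → T (injectiveᵇ v)
  injectiveᵇ⁺ {k} v inj = T-all⁺ _ {cartesianProduct (allFin k) (allFin k)} λ {(i , j)} _ → from T-∨ (decide i j)
    where
    decide : ∀ i j → T (i ==ᶠ j) ⊎ T (not (lookup v i ==ᶠ lookup v j))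
    decide i j with i ≟ j
    ... | yes _ = inj₁ _
    ... | no i≢j = inj₂ (T-not-==ᶠ⁺ (i≢j ∘ inj i j))

  module _ (H : Pattern) (G : Graph n) (v : Vec (Fin n) (k H)) where

    embedding⇒injective : T (embeddingᵇ H G v) → ∀ i j → lookup v i ≡ lookup v j → i ≡ j
    embedding⇒injective h = injectiveᵇ⁻ v (proj₁ (to T-∧ h))

    embedding⇒edge : T (embeddingᵇ H G v) → ∀ {i j} → (i , j) ∈ edges H → T (G (lookup v i) (lookup v j))
    embedding⇒edge h = T-all⁻ _ (proj₂ (to (T-∧ {injectiveᵇ v}) h))

    embedding⁺ : (∀ i j → lookup v i ≡ lookup v j → i ≡ j) →
                 (∀ {i j} → (i , j) ∈ edges H → T (G (lookup v i) (lookup v j))) → T (embeddingᵇ H G v)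
    embedding⁺ inj edge = from T-∧ (injectiveᵇ⁺ v inj , T-all⁺ _ edge)

  ∈-allVecs : ∀ {k} (v : Vec (Fin n) k) → v ∈ allVecs k n
  ∈-allVecs [] = here refl
  ∈-allVecs (x ∷ v) =
    ∈-concatMap⁺ (λ w → map (_∷ w) (allFin n))
      (Any.map (λ { refl → ∈-map⁺ (_∷ v) (∈-allFin x) }) (∈-allVecs v))

  module _ (H : Pattern) (G : Graph n) where

    #emb≡0⇒¬embedding : #emb H G ≡ 0 → ∀ v → ¬ T (embeddingᵇ H G v)
    #emb≡0⇒¬embedding #emb≡0 v h =
      nonempty (∈-filter⁺ (λ v → T? (embeddingᵇ H G v)) {xs = allVecs (k H) n} (∈-allVecs v) h) #emb≡0
      where
      nonempty : ∀ {A : Set} {x : A} {xs} → x ∈ xs → length xs ≢ 0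
      nonempty (here _) ()
      nonempty (there _) ()

    ¬embedding⇒#emb≡0 : (∀ v → ¬ T (embeddingᵇ H G v)) → #emb H G ≡ 0
    ¬embedding⇒#emb≡0 ¬emb =
      cong length (filter-none (λ v → T? (embeddingᵇ H G v)) (universal ¬emb (allVecs (k H) n)))

    free⇒¬embedding : T (free H G) → ∀ v → ¬ T (embeddingᵇ H G v)
    free⇒¬embedding h = #emb≡0⇒¬embedding (≡ᵇ⇒≡ (#emb H G) 0 h)

    ¬embedding⇒free : (∀ v → ¬ T (embeddingᵇ H G v)) → T (free H G)
    ¬embedding⇒free ¬emb = ≡⇒≡ᵇ (#emb H G) 0 (¬embedding⇒#emb≡0 ¬emb)

    ¬embedding⇒#copies≡0 : (∀ v → ¬ T (embeddingᵇ H G v)) → #copies H G ≡ 0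
    ¬embedding⇒#copies≡0 ¬emb rewrite ¬embedding⇒#emb≡0 ¬emb = 0-div (#emb H (patternGraph H))
      where
      0-div : ∀ d → 0 div d ≡ 0
      0-div zero = refl
      0-div (suc _) = refl

-- MaxTurn and MiniTurn are invariants that Mini maintains on the positions with Max, resp. Mini, to move.
record MiniStrategy {n : ℕ} (H F : Pattern) (b : ℕ) : Set₁ where
  field
    MaxTurn MiniTurn : Graph n → Set
    maxTurn-score : ∀ {G} → MaxTurn G → #copies H G ≤ b
    miniTurn-score : ∀ {G} → MiniTurn G → #copies H G ≤ b
    maxTurn-move : ∀ {G e} → MaxTurn G → e ∈ legalMoves F G → MiniTurn (addEdge G e)
    miniTurn-reply : ∀ {G e} → MiniTurn G → e ∈ legalMoves F G →
                     ∃ λ e′ → e′ ∈ legalMoves F G × MaxTurn (addEdge G e′)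

module _ {n : ℕ} {H F : Pattern} {b : ℕ} (σ : MiniStrategy {n} H F b) where
  open MiniStrategy σ

  value-Max≤ : ∀ fuel {G} → MaxTurn G → value H F fuel Max G ≤ b
  value-Mini≤ : ∀ fuel {G} → MiniTurn G → value H F fuel Mini G ≤ b

  value-Max≤ fuel {G} t with legalMoves F G in legal
  value-Max≤ fuel t | [] = maxTurn-score t
  value-Max≤ zero t | _ ∷ _ = maxTurn-score t
  value-Max≤ (suc fuel) {G} t | m ∷ ms =
    maxList-≤ (λ e → value H F fuel Mini (addEdge G e)) m ms
      λ e∈ → value-Mini≤ fuel (maxTurn-move t (subst (_ ∈_) (sym legal) e∈))

  value-Mini≤ fuel {G} t with legalMoves F G in legal
  value-Mini≤ fuel t | [] = miniTurn-score t
  value-Mini≤ zero t | _ ∷ _ = miniTurn-score t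
  value-Mini≤ (suc fuel) {G} t | m ∷ ms with miniTurn-reply t (subst (m ∈_) (sym legal) (here refl))
  ... | e , e∈ , t′ =
    minList-≤ (λ e → value H F fuel Max (addEdge G e)) m ms (subst (e ∈_) legal e∈) (value-Max≤ fuel t′)

module _ {n : ℕ} where

  infix 4 _∼[_]_

  -- A record rather than T (G x y), so that G, x and y can be inferred from an edge.
  record _∼[_]_ (x : Fin n) (G : Graph n) (y : Fin n) : Set where
    constructor edge
    field edge⁻ : T (G x y)
  open _∼[_]_ public

  Symmetric : Graph n → Set
  Symmetric G = ∀ {x y} → x ∼[ G ] y → y ∼[ G ] x

  Loopless : Graph n → Set
  Loopless G = ∀ {x} → ¬ x ∼[ G ] x

  Isolated : Graph n → Fin n → Set
  Isolated G x = ∀ {y} → ¬ x ∼[ G ] y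

  Neighbours₁ : Graph n → Fin n → Fin n → Set
  Neighbours₁ G x a = x ∼[ G ] a × (∀ {y} → x ∼[ G ] y → y ≡ a)

  Neighbours₂ : Graph n → Fin n → Fin n → Fin n → Set
  Neighbours₂ G x a b = a ≢ b × x ∼[ G ] a × x ∼[ G ] b × (∀ {y} → x ∼[ G ] y → y ≡ a ⊎ y ≡ b)

  Degree≡2 : Graph n → Fin n → Set
  Degree≡2 G x = ∃ λ a → ∃ λ b → Neighbours₂ G x a b

  Degree≤2 : Graph n → Fin n → Set
  Degree≤2 G x = ∃ λ p → ∃ λ q → ∀ {y} → x ∼[ G ] y → y ≡ p ⊎ y ≡ q

  End : Graph n → List (Fin n) → Fin n → Set
  End G L x = ∃ λ a → a ∈ L × Neighbours₁ G x a

  Inner : Graph n → List (Fin n) → Fin n → Set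
  Inner G L x = ∃ λ a → ∃ λ b → a ∈ L × b ∈ L × Neighbours₂ G x a b

  Closed : Graph n → List (Fin n) → Set
  Closed G L = ∀ {x y} → x ∈ L → x ∼[ G ] y → y ∈ L

  InSmallComponent : Graph n → Fin n → Set
  InSmallComponent G x = ∃ λ L → length L ≤ 5 × x ∈ L × Closed G L

  -- x lies on a cycle of length at most 5; having degree 2, its vertices are never touched again.
  Settled : Graph n → Fin n → Set
  Settled G x = ∃ λ L → length L ≤ 5 × x ∈ L × (∀ {y} → y ∈ L → Inner G L y)

  module _ {G : Graph n} where

    ∼⇒≢ : Loopless G → ∀ {x y} → x ∼[ G ] y → x ≢ y
    ∼⇒≢ loopless x∼y refl = loopless x∼y

    ∼⇒≢isolated : ∀ {x y z} → x ∼[ G ] y → Isolated G z → x ≢ z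
    ∼⇒≢isolated x∼y iso refl = iso x∼y

    isolated⇒¬degree≡2 : ∀ {x} → Isolated G x → ¬ Degree≡2 G x
    isolated⇒¬degree≡2 iso (_ , _ , _ , x∼a , _) = iso x∼a

    neighbours₁⇒¬degree≡2 : ∀ {x c} → Neighbours₁ G x c → ¬ Degree≡2 G x
    neighbours₁⇒¬degree≡2 (_ , only) (_ , _ , a≢b , x∼a , x∼b , _) = a≢b (trans (only x∼a) (sym (only x∼b)))

    isolated⇒degree≤2 : ∀ {x} → Isolated G x → Degree≤2 G x
    isolated⇒degree≤2 {x} iso = x , x , ⊥-elim ∘ iso

    neighbours₁⇒degree≤2 : ∀ {x a} → Neighbours₁ G x a → Degree≤2 G x
    neighbours₁⇒degree≤2 {a = a} (_ , only) = a , a , inj₁ ∘ only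

    neighbours₂⇒degree≤2 : ∀ {x a b} → Neighbours₂ G x a b → Degree≤2 G x
    neighbours₂⇒degree≤2 {a = a} {b} (_ , _ , _ , only) = a , b , only

    neighbours₂-swap : ∀ {x a b} → Neighbours₂ G x a b → Neighbours₂ G x b a
    neighbours₂-swap (a≢b , x∼a , x∼b , only) = a≢b ∘ sym , x∼b , x∼a , Sum.swap ∘ only

    end-∼ : ∀ {L x y} → End G L x → x ∼[ G ] y → y ∈ L
    end-∼ (_ , a∈L , _ , only) x∼y rewrite only x∼y = a∈L

    inner-∼ : ∀ {L x y} → Inner G L x → x ∼[ G ] y → y ∈ L
    inner-∼ (_ , _ , a∈L , b∈L , _ , _ , _ , only) x∼y =
      [ (λ { refl → a∈L }) , (λ { refl → b∈L }) ]′ (only x∼y)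

    isolated⇒inSmallComponent : ∀ {x} → Isolated G x → InSmallComponent G x
    isolated⇒inSmallComponent {x} iso = x ∷ [] , s≤s z≤n , ∈₀ , λ { ∈₀ x∼y → ⊥-elim (iso x∼y) }

    settled⇒inSmallComponent : ∀ {x} → Settled G x → InSmallComponent G x
    settled⇒inSmallComponent (L , small , x∈L , inner) = L , small , x∈L , inner-∼ ∘ inner

    settled⇒degree≡2 : ∀ {x} → Settled G x → Degree≡2 G x
    settled⇒degree≡2 (_ , _ , x∈L , inner) with inner x∈L
    ... | a , b , _ , _ , nb = a , b , nb

    smallComponents⇒¬P₆ : (∀ x → InSmallComponent G x) → ∀ v → ¬ T (embeddingᵇ P₆ G v)
    smallComponents⇒¬P₆ small v@(v₀ ∷ _ ∷ _ ∷ _ ∷ _ ∷ _ ∷ []) emb with small v₀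
    ... | L , |L|≤5 , v₀∈L , closed =
      covered⇒¬injective (List.lookup L) (lookup v) (s≤s |L|≤5)
        (λ i → Any.index (cover i) , sym (lookup-index (cover i))) (embedding⇒injective P₆ G v emb)
      where
      follow : ∀ {i j} → (i , j) ∈ edges P₆ → lookup v i ∈ L → lookup v j ∈ L
      follow ij∈P₆ vᵢ∈L = closed vᵢ∈L (edge (embedding⇒edge P₆ G v emb ij∈P₆))
      v₁∈L = follow ∈₀ v₀∈L
      v₂∈L = follow ∈₁ v₁∈L
      v₃∈L = follow ∈₂ v₂∈L
      v₄∈L = follow ∈₃ v₃∈L
      v₅∈L = follow ∈₄ v₄∈L
      cover : ∀ i → lookup v i ∈ L
      cover zero = v₀∈L
      cover (suc zero) = v₁∈L
      cover (suc (suc zero)) = v₂∈L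
      cover (suc (suc (suc zero))) = v₃∈L
      cover (suc (suc (suc (suc zero)))) = v₄∈L
      cover (suc (suc (suc (suc (suc zero))))) = v₅∈L

    degree≤2⇒¬S₄ : (∀ x → Degree≤2 G x) → ∀ v → ¬ T (embeddingᵇ S₄ G v)
    degree≤2⇒¬S₄ deg v@(c ∷ _ ∷ _ ∷ _ ∷ []) emb with deg c
    ... | p , q , only = covered⇒¬injective (lookup (p ∷ q ∷ [])) leaf ≤-refl cover leaf-injective
      where
      leaf : Fin 3 → Fin n
      leaf i = lookup v (suc i)
      c∼leaf : ∀ i → c ∼[ G ] leaf i
      c∼leaf zero = edge (embedding⇒edge S₄ G v emb ∈₀)
      c∼leaf (suc zero) = edge (embedding⇒edge S₄ G v emb ∈₁)
      c∼leaf (suc (suc zero)) = edge (embedding⇒edge S₄ G v emb ∈₂)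
      cover : ∀ i → ∃ λ j → lookup (p ∷ q ∷ []) j ≡ leaf i
      cover i with only (c∼leaf i)
      ... | inj₁ leaf≡p = zero , sym leaf≡p
      ... | inj₂ leaf≡q = suc zero , sym leaf≡q
      leaf-injective : ∀ i j → leaf i ≡ leaf j → i ≡ j
      leaf-injective i j same = suc-injective (embedding⇒injective S₄ G v emb (suc i) (suc j) same)

    star⇒S₄ : ∀ {c a b d} → Unique (c ∷ a ∷ b ∷ d ∷ []) → c ∼[ G ] a → c ∼[ G ] b → c ∼[ G ] d →
              T (embeddingᵇ S₄ G (c ∷ a ∷ b ∷ d ∷ []))
    star⇒S₄ {c} {a} {b} {d} distinct c∼a c∼b c∼d =
      embedding⁺ S₄ G (c ∷ a ∷ b ∷ d ∷ []) (lookup-injective distinct) λ where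
        ∈₀ → edge⁻ c∼a
        ∈₁ → edge⁻ c∼b
        ∈₂ → edge⁻ c∼d

  module _ {F : Pattern} {G : Graph n} {u w : Fin n} where

    legalMove⁻ : (u , w) ∈ legalMoves F G → u ≢ w × ¬ u ∼[ G ] w × T (free F (addEdge G (u , w)))
    legalMove⁻ uw∈
      with ∈-filter⁻ (λ e → T? (not (G (proj₁ e) (proj₂ e)) ∧ free F (addEdge G e))) {xs = edgesKn n} uw∈
    ... | uw∈Kₙ , legal
      with ∈-filter⁻ (λ e → T? (toℕ (proj₁ e) <ᵇ toℕ (proj₂ e)))
                     {xs = cartesianProduct (allFin n) (allFin n)} uw∈Kₙ
    ... | _ , u<w = (λ { refl → <-irrefl refl (<ᵇ⇒< (toℕ u) (toℕ u) u<w) })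
                  , (λ u∼w → T-not⇒¬T (proj₁ (to T-∧ legal)) (edge⁻ u∼w))
                  , proj₂ (to (T-∧ {not (G u w)}) legal)

    legalMove⁺ : toℕ u < toℕ w → ¬ u ∼[ G ] w → T (free F (addEdge G (u , w))) → (u , w) ∈ legalMoves F G
    legalMove⁺ u<w ¬u∼w F-free =
      ∈-filter⁺ (λ e → T? (not (G (proj₁ e) (proj₂ e)) ∧ free F (addEdge G e)))
        (∈-filter⁺ (λ e → T? (toℕ (proj₁ e) <ᵇ toℕ (proj₂ e)))
          (∈-cartesianProduct⁺ (∈-allFin u) (∈-allFin w)) (<⇒<ᵇ u<w))
        (from T-∧ (¬T⇒T-not (¬u∼w ∘ edge) , F-free))

  -- addEdge G (u , w) and addEdge G (w , u) are different functions; this record lets us use either.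
  record EdgeAdded (G G′ : Graph n) (u w : Fin n) : Set where
    field
      kept : ∀ {x y} → x ∼[ G ] y → x ∼[ G′ ] y
      added : u ∼[ G′ ] w
      added′ : w ∼[ G′ ] u
      origin : ∀ {x y} → x ∼[ G′ ] y → x ∼[ G ] y ⊎ (x ≡ u × y ≡ w) ⊎ (x ≡ w × y ≡ u)
  open EdgeAdded public

  flip-added : ∀ {G G′ u w} → EdgeAdded G G′ u w → EdgeAdded G G′ w u
  flip-added A = record
    { kept = kept A ; added = added′ A ; added′ = added A ; origin = Sum.map₂ Sum.swap ∘ origin A }

  addEdge-added : ∀ G u w → EdgeAdded G (addEdge G (u , w)) u w
  addEdge-added G u w = record
    { kept = λ x∼y → edge (from T-∨ (inj₁ (edge⁻ x∼y)))
    ; added = edge (from (T-∨ {G u w}) (inj₂ (from (T-∨ {u ==ᶠ u ∧ w ==ᶠ w}) (inj₁ (diagonal u w)))))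
    ; added′ = edge (from (T-∨ {G w u}) (inj₂ (from (T-∨ {w ==ᶠ u ∧ u ==ᶠ w}) (inj₂ (diagonal w u)))))
    ; origin = decode }
    where
    diagonal : ∀ a b → T ((a ==ᶠ a) ∧ (b ==ᶠ b))
    diagonal a b = from T-∧ (T-==ᶠ⁺ {a = a} refl , T-==ᶠ⁺ {a = b} refl)
    both : ∀ {x y a b} → T ((x ==ᶠ a) ∧ (y ==ᶠ b)) → x ≡ a × y ≡ b
    both h = Product.map T-==ᶠ⁻ T-==ᶠ⁻ (to T-∧ h)
    decode : ∀ {x y} → x ∼[ addEdge G (u , w) ] y → x ∼[ G ] y ⊎ (x ≡ u × y ≡ w) ⊎ (x ≡ w × y ≡ u)
    decode {x} {y} (edge h) with to (T-∨ {G x y}) h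
    ... | inj₁ old = inj₁ (edge old)
    ... | inj₂ new = inj₂ (Sum.map both both (to (T-∨ {x ==ᶠ u ∧ y ==ᶠ w}) new))

  module _ {G G′ : Graph n} {u w : Fin n} (A : EdgeAdded G G′ u w) where

    Untouched : Fin n → Set
    Untouched x = x ≢ u × x ≢ w

    ∼-preserved : ∀ {x y} → Untouched x → x ∼[ G′ ] y → x ∼[ G ] y
    ∼-preserved (x≢u , x≢w) x∼y with origin A x∼y
    ... | inj₁ old = old
    ... | inj₂ (inj₁ (x≡u , _)) = contradiction x≡u x≢u
    ... | inj₂ (inj₂ (x≡w , _)) = contradiction x≡w x≢w

    isolated-preserved : ∀ {x} → Isolated G x → Untouched x → Isolated G′ x
    isolated-preserved iso x≁ = iso ∘ ∼-preserved x≁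

    neighbours₁-preserved : ∀ {x a} → Neighbours₁ G x a → Untouched x → Neighbours₁ G′ x a
    neighbours₁-preserved (x∼a , only) x≁ = kept A x∼a , only ∘ ∼-preserved x≁

    neighbours₂-preserved : ∀ {x a b} → Neighbours₂ G x a b → Untouched x → Neighbours₂ G′ x a b
    neighbours₂-preserved (a≢b , x∼a , x∼b , only) x≁ =
      a≢b , kept A x∼a , kept A x∼b , only ∘ ∼-preserved x≁

    isolated-extended : Isolated G u → Neighbours₁ G′ u w
    isolated-extended iso = added A , only ∘ origin A
      where
      only : ∀ {y} → u ∼[ G ] y ⊎ (u ≡ u × y ≡ w) ⊎ (u ≡ w × y ≡ u) → y ≡ w
      only (inj₁ u∼y) = contradiction u∼y iso
      only (inj₂ (inj₁ (_ , y≡w))) = y≡w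
      only (inj₂ (inj₂ (u≡w , y≡u))) = trans y≡u u≡w

    neighbours₁-extended : ∀ {a} → Neighbours₁ G u a → a ≢ w → Neighbours₂ G′ u a w
    neighbours₁-extended {a} (u∼a , only) a≢w = a≢w , kept A u∼a , added A , only′ ∘ origin A
      where
      only′ : ∀ {y} → u ∼[ G ] y ⊎ (u ≡ u × y ≡ w) ⊎ (u ≡ w × y ≡ u) → y ≡ a ⊎ y ≡ w
      only′ (inj₁ u∼y) = inj₁ (only u∼y)
      only′ (inj₂ (inj₁ (_ , y≡w))) = inj₂ y≡w
      only′ (inj₂ (inj₂ (u≡w , y≡u))) = inj₂ (trans y≡u u≡w)

    symmetric-preserved : Symmetric G → Symmetric G′
    symmetric-preserved sym-G x∼y with origin A x∼y
    ... | inj₁ old = kept A (sym-G old)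
    ... | inj₂ (inj₁ (refl , refl)) = added′ A
    ... | inj₂ (inj₂ (refl , refl)) = added A

    loopless-preserved : Loopless G → u ≢ w → Loopless G′
    loopless-preserved loopless u≢w x∼x with origin A x∼x
    ... | inj₁ old = loopless old
    ... | inj₂ (inj₁ (refl , refl)) = u≢w refl
    ... | inj₂ (inj₂ (refl , refl)) = u≢w refl

    settled-preserved : ¬ Degree≡2 G u → ¬ Degree≡2 G w → ∀ {x} → Settled G x → Settled G′ x
    settled-preserved ¬deg-u ¬deg-w (L , small , x∈L , inner) = L , small , x∈L , inner′
      where
      inner′ : ∀ {y} → y ∈ L → Inner G′ L y
      inner′ y∈L with inner y∈L
      ... | a , b , a∈L , b∈L , nb =
        a , b , a∈L , b∈L ,
        neighbours₂-preserved nb ((λ { refl → ¬deg-u (_ , _ , nb) }) , (λ { refl → ¬deg-w (_ , _ , nb) }))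

    S₄-free⇒¬degree≡2 : Loopless G → u ≢ w → ¬ u ∼[ G ] w → T (free S₄ G′) → ¬ Degree≡2 G u
    S₄-free⇒¬degree≡2 loopless u≢w ¬u∼w S₄-free (a , b , a≢b , u∼a , u∼b , _) =
      free⇒¬embedding S₄ G′ S₄-free (u ∷ a ∷ b ∷ w ∷ [])
        (star⇒S₄ distinct (kept A u∼a) (kept A u∼b) (added A))
      where
      distinct : Unique (u ∷ a ∷ b ∷ w ∷ [])
      distinct = ((λ { refl → loopless u∼a }) ∷ (λ { refl → loopless u∼b }) ∷ u≢w ∷ [])
               ∷ (a≢b ∷ (λ { refl → ¬u∼w u∼a }) ∷ [])
               ∷ ((λ { refl → ¬u∼w u∼b }) ∷ [])
               ∷ [] ∷ []

  data PathShape : Set where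
    noPath : PathShape
    path₂ : (a b : Fin n) → PathShape
    path₃ : (a b c : Fin n) → PathShape
    path₄ : (a b c d : Fin n) → PathShape
    path₅ : (a b c d e : Fin n) → PathShape

  vertices : PathShape → List (Fin n)
  vertices noPath = []
  vertices (path₂ a b) = a ∷ b ∷ []
  vertices (path₃ a b c) = a ∷ b ∷ c ∷ []
  vertices (path₄ a b c d) = a ∷ b ∷ c ∷ d ∷ []
  vertices (path₅ a b c d e) = a ∷ b ∷ c ∷ d ∷ e ∷ []

  length-vertices≤5 : ∀ s → length (vertices s) ≤ 5
  length-vertices≤5 noPath = z≤n
  length-vertices≤5 (path₂ _ _) = s≤s (s≤s z≤n)
  length-vertices≤5 (path₃ _ _ _) = s≤s (s≤s (s≤s z≤n))
  length-vertices≤5 (path₄ _ _ _ _) = s≤s (s≤s (s≤s (s≤s z≤n)))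
  length-vertices≤5 (path₅ _ _ _ _ _) = ≤-refl

  reversePath : PathShape → PathShape
  reversePath noPath = noPath
  reversePath (path₂ a b) = path₂ b a
  reversePath (path₃ a b c) = path₃ c b a
  reversePath (path₄ a b c d) = path₄ d c b a
  reversePath (path₅ a b c d e) = path₅ e d c b a

  vertices-reverse : ∀ s → vertices (reversePath s) ≡ List.reverse (vertices s)
  vertices-reverse noPath = refl
  vertices-reverse (path₂ _ _) = refl
  vertices-reverse (path₃ _ _ _) = refl
  vertices-reverse (path₄ _ _ _ _) = refl
  vertices-reverse (path₅ _ _ _ _ _) = refl

  PathComponent : Graph n → PathShape → Set
  PathComponent G noPath = ⊤
  PathComponent G (path₂ a b) = Neighbours₁ G a b × Neighbours₁ G b a
  PathComponent G (path₃ a b c) = Neighbours₁ G a b × Neighbours₂ G b a c × Neighbours₁ G c b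
  PathComponent G (path₄ a b c d) =
    Neighbours₁ G a b × Neighbours₂ G b a c × Neighbours₂ G c b d × Neighbours₁ G d c
  PathComponent G (path₅ a b c d e) =
    Neighbours₁ G a b × Neighbours₂ G b a c × Neighbours₂ G c b d × Neighbours₂ G d c e × Neighbours₁ G e d

  module _ {G : Graph n} where

    pathComponent-reverse : ∀ s → PathComponent G s → PathComponent G (reversePath s)
    pathComponent-reverse noPath _ = _
    pathComponent-reverse (path₂ _ _) (p , q) = q , p
    pathComponent-reverse (path₃ _ _ _) (p , q , r) = r , neighbours₂-swap q , p
    pathComponent-reverse (path₄ _ _ _ _) (p , q , r , s) = s , neighbours₂-swap r , neighbours₂-swap q , p
    pathComponent-reverse (path₅ _ _ _ _ _) (p , q , r , s , t) =
      t , neighbours₂-swap s , neighbours₂-swap r , neighbours₂-swap q , p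

    pathComponent-vertex : ∀ s → PathComponent G s → ∀ {x} → x ∈ vertices s →
                           End G (vertices s) x ⊎ Inner G (vertices s) x
    pathComponent-vertex (path₂ _ _) (p , _) ∈₀ = inj₁ (_ , ∈₁ , p)
    pathComponent-vertex (path₂ _ _) (_ , q) ∈₁ = inj₁ (_ , ∈₀ , q)
    pathComponent-vertex (path₃ _ _ _) (p , _) ∈₀ = inj₁ (_ , ∈₁ , p)
    pathComponent-vertex (path₃ _ _ _) (_ , q , _) ∈₁ = inj₂ (_ , _ , ∈₀ , ∈₂ , q)
    pathComponent-vertex (path₃ _ _ _) (_ , _ , r) ∈₂ = inj₁ (_ , ∈₁ , r)
    pathComponent-vertex (path₄ _ _ _ _) (p , _) ∈₀ = inj₁ (_ , ∈₁ , p)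
    pathComponent-vertex (path₄ _ _ _ _) (_ , q , _) ∈₁ = inj₂ (_ , _ , ∈₀ , ∈₂ , q)
    pathComponent-vertex (path₄ _ _ _ _) (_ , _ , r , _) ∈₂ = inj₂ (_ , _ , ∈₁ , ∈₃ , r)
    pathComponent-vertex (path₄ _ _ _ _) (_ , _ , _ , s) ∈₃ = inj₁ (_ , ∈₂ , s)
    pathComponent-vertex (path₅ _ _ _ _ _) (p , _) ∈₀ = inj₁ (_ , ∈₁ , p)
    pathComponent-vertex (path₅ _ _ _ _ _) (_ , q , _) ∈₁ = inj₂ (_ , _ , ∈₀ , ∈₂ , q)
    pathComponent-vertex (path₅ _ _ _ _ _) (_ , _ , r , _) ∈₂ = inj₂ (_ , _ , ∈₁ , ∈₃ , r)
    pathComponent-vertex (path₅ _ _ _ _ _) (_ , _ , _ , s , _) ∈₃ = inj₂ (_ , _ , ∈₂ , ∈₄ , s)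
    pathComponent-vertex (path₅ _ _ _ _ _) (_ , _ , _ , _ , t) ∈₄ = inj₁ (_ , ∈₃ , t)

    pathComponent-degree≤2 : ∀ s → PathComponent G s → ∀ {x} → x ∈ vertices s → Degree≤2 G x
    pathComponent-degree≤2 s component x∈s with pathComponent-vertex s component x∈s
    ... | inj₁ (_ , _ , nb) = neighbours₁⇒degree≤2 nb
    ... | inj₂ (_ , _ , _ , _ , nb) = neighbours₂⇒degree≤2 nb

    pathComponent-small : ∀ s → PathComponent G s → ∀ {x} → x ∈ vertices s → InSmallComponent G x
    pathComponent-small s component x∈s =
      vertices s , length-vertices≤5 s , x∈s , [ end-∼ , inner-∼ ]′ ∘ pathComponent-vertex s component

    isolated∉path : ∀ s → PathComponent G s → ∀ {x} → Isolated G x → x ∉ vertices s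
    isolated∉path s component iso x∈s with pathComponent-vertex s component x∈s
    ... | inj₁ (_ , _ , x∼a , _) = iso x∼a
    ... | inj₂ (_ , _ , _ , _ , _ , x∼a , _) = iso x∼a

    path₂-adjacent : ∀ {a b x y} → PathComponent G (path₂ a b) →
                     x ∈ vertices (path₂ a b) → y ∈ vertices (path₂ a b) → x ≢ y → x ∼[ G ] y
    path₂-adjacent _ ∈₀ ∈₀ x≢y = contradiction refl x≢y
    path₂-adjacent ((a∼b , _) , _) ∈₀ ∈₁ _ = a∼b
    path₂-adjacent (_ , (b∼a , _)) ∈₁ ∈₀ _ = b∼a
    path₂-adjacent _ ∈₁ ∈₁ x≢y = contradiction refl x≢y

    ends₃ : ∀ {a b c x} → PathComponent G (path₃ a b c) →
            x ∈ vertices (path₃ a b c) → ¬ Degree≡2 G x → x ≡ a ⊎ x ≡ c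
    ends₃ _ ∈₀ _ = inj₁ refl
    ends₃ (_ , b-ac , _) ∈₁ ¬deg = contradiction (_ , _ , b-ac) ¬deg
    ends₃ _ ∈₂ _ = inj₂ refl

    ends₄ : ∀ {a b c d x} → PathComponent G (path₄ a b c d) →
            x ∈ vertices (path₄ a b c d) → ¬ Degree≡2 G x → x ≡ a ⊎ x ≡ d
    ends₄ _ ∈₀ _ = inj₁ refl
    ends₄ (_ , b-ac , _) ∈₁ ¬deg = contradiction (_ , _ , b-ac) ¬deg
    ends₄ (_ , _ , c-bd , _) ∈₂ ¬deg = contradiction (_ , _ , c-bd) ¬deg
    ends₄ _ ∈₃ _ = inj₂ refl

    module _ (loopless : Loopless G) where

      ends-apart₃ : ∀ {a b c} → PathComponent G (path₃ a b c) → a ≢ c × ¬ a ∼[ G ] c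
      ends-apart₃ ((_ , only-b) , (a≢c , _ , b∼c , _) , _) =
        a≢c , λ a∼c → ∼⇒≢ loopless b∼c (sym (only-b a∼c))

      ends-apart₄ : ∀ {a b c d} → PathComponent G (path₄ a b c d) → a ≢ d × ¬ a ∼[ G ] d
      ends-apart₄ ((_ , only-b) , (a≢c , b∼a , _) , (_ , c∼b , _) , (d∼c , only-c)) =
        (λ { refl → ∼⇒≢ loopless c∼b (only-b d∼c) }) ,
        λ a∼d → case only-b a∼d of λ { refl → a≢c (only-c b∼a) }

      ends-apart₅ : ∀ {a b c d e} → PathComponent G (path₅ a b c d e) → a ≢ e × ¬ a ∼[ G ] e
      ends-apart₅ ((_ , only-b) , (a≢c , b∼a , b∼c , _) , (b≢d , _) , _ , (e∼d , only-d)) =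
        (λ { refl → b≢d (sym (only-b e∼d)) }) ,
        λ a∼e → case only-b a∼e of λ { refl → a≢c (trans (only-d b∼a) (sym (only-d b∼c))) }

  pathComponent-preserved : ∀ {G G′ u w} (A : EdgeAdded G G′ u w) s → PathComponent G s →
                            (∀ {x} → x ∈ vertices s → Untouched A x) → PathComponent G′ s
  pathComponent-preserved A noPath _ _ = _
  pathComponent-preserved A (path₂ _ _) (p , q) away =
    neighbours₁-preserved A p (away ∈₀) , neighbours₁-preserved A q (away ∈₁)
  pathComponent-preserved A (path₃ _ _ _) (p , q , r) away =
    neighbours₁-preserved A p (away ∈₀) , neighbours₂-preserved A q (away ∈₁) ,
    neighbours₁-preserved A r (away ∈₂)
  pathComponent-preserved A (path₄ _ _ _ _) (p , q , r , s) away =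
    neighbours₁-preserved A p (away ∈₀) , neighbours₂-preserved A q (away ∈₁) ,
    neighbours₂-preserved A r (away ∈₂) , neighbours₁-preserved A s (away ∈₃)
  pathComponent-preserved A (path₅ _ _ _ _ _) (p , q , r , s , t) away =
    neighbours₁-preserved A p (away ∈₀) , neighbours₂-preserved A q (away ∈₁) ,
    neighbours₂-preserved A r (away ∈₂) , neighbours₂-preserved A s (away ∈₃) ,
    neighbours₁-preserved A t (away ∈₄)

  record Layout (G : Graph n) (s t : PathShape) : Set where
    field
      symmetric : Symmetric G
      loopless : Loopless G
      component₁ : PathComponent G s
      component₂ : PathComponent G t
      disjoint : ∀ {x} → x ∈ vertices s → x ∉ vertices t
      classify : ∀ x → Isolated G x ⊎ Settled G x ⊎ x ∈ vertices s ⊎ x ∈ vertices t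
  open Layout public

  layout-empty : Layout emptyGraph noPath noPath
  layout-empty = record
    { symmetric = λ () ; loopless = λ () ; component₁ = _ ; component₂ = _
    ; disjoint = λ () ; classify = λ _ → inj₁ λ () }

  module _ {G : Graph n} {s t : PathShape} (I : Layout G s t) where

    layout-degree≤2 : ∀ x → Degree≤2 G x
    layout-degree≤2 x with classify I x
    ... | inj₁ iso = isolated⇒degree≤2 iso
    ... | inj₂ (inj₁ settled) = neighbours₂⇒degree≤2 (proj₂ (proj₂ (settled⇒degree≡2 settled)))
    ... | inj₂ (inj₂ (inj₁ x∈s)) = pathComponent-degree≤2 s (component₁ I) x∈s
    ... | inj₂ (inj₂ (inj₂ x∈t)) = pathComponent-degree≤2 t (component₂ I) x∈t

    layout-small : ∀ x → InSmallComponent G x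
    layout-small x with classify I x
    ... | inj₁ iso = isolated⇒inSmallComponent iso
    ... | inj₂ (inj₁ settled) = settled⇒inSmallComponent settled
    ... | inj₂ (inj₂ (inj₁ x∈s)) = pathComponent-small s (component₁ I) x∈s
    ... | inj₂ (inj₂ (inj₂ x∈t)) = pathComponent-small t (component₂ I) x∈t

    layout-S₄-free : T (free S₄ G)
    layout-S₄-free = ¬embedding⇒free S₄ G (degree≤2⇒¬S₄ layout-degree≤2)

    layout-#copies : #copies P₆ G ≡ 0
    layout-#copies = ¬embedding⇒#copies≡0 P₆ G (smallComponents⇒¬P₆ layout-small)

    layout-swap : Layout G t s
    layout-swap = record
      { symmetric = symmetric I ; loopless = loopless I ; component₁ = component₂ I ; component₂ = component₁ I
      ; disjoint = λ x∈t x∈s → disjoint I x∈s x∈t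
      ; classify = Sum.map₂ (Sum.map₂ Sum.swap) ∘ classify I }

    layout-reverse : Layout G (reversePath s) t
    layout-reverse = record
      { symmetric = symmetric I ; loopless = loopless I
      ; component₁ = pathComponent-reverse s (component₁ I) ; component₂ = component₂ I
      ; disjoint = disjoint I ∘ Any.reverse⁻ ∘ subst (_ ∈_) (vertices-reverse s)
      ; classify = Sum.map₂ (Sum.map₂ (Sum.map₁ (subst (_ ∈_) (sym (vertices-reverse s)) ∘ Any.reverse⁺)))
                   ∘ classify I }

  classify-¬degree≡2 : ∀ {G s x} → Layout G s noPath → ¬ Degree≡2 G x → Isolated G x ⊎ x ∈ vertices s
  classify-¬degree≡2 {x = x} I ¬deg with classify I x
  ... | inj₁ iso = inj₁ iso
  ... | inj₂ (inj₁ settled) = contradiction (settled⇒degree≡2 settled) ¬deg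
  ... | inj₂ (inj₂ (inj₁ x∈s)) = inj₂ x∈s

  Placed : Graph n → PathShape → PathShape → Fin n → Set
  Placed G s t x = Settled G x ⊎ x ∈ vertices s ⊎ x ∈ vertices t

  module _ {G G′ : Graph n} {u w : Fin n} (A : EdgeAdded G G′ u w) where

    -- Isolated and settled vertices off the new edge keep their status, so only the vertices of the old
    -- paths and the two endpoints have to be placed anew.
    layout-step : ∀ {s t s′ t′} → Layout G s t → u ≢ w → ¬ Degree≡2 G u → ¬ Degree≡2 G w →
                  PathComponent G′ s′ → PathComponent G′ t′ →
                  (∀ {x} → x ∈ vertices s′ → x ∉ vertices t′) →
                  (∀ {x} → x ∈ vertices s → Placed G′ s′ t′ x) →
                  (∀ {x} → x ∈ vertices t → Placed G′ s′ t′ x) →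
                  Placed G′ s′ t′ u → Placed G′ s′ t′ w → Layout G′ s′ t′
    layout-step {s′ = s′} {t′} I u≢w ¬deg-u ¬deg-w component₁′ component₂′ disjoint′
                place-s place-t place-u place-w = record
      { symmetric = symmetric-preserved A (symmetric I)
      ; loopless = loopless-preserved A (loopless I) u≢w
      ; component₁ = component₁′ ; component₂ = component₂′ ; disjoint = disjoint′
      ; classify = classify′ }
      where
      classify′ : ∀ x → Isolated G′ x ⊎ Placed G′ s′ t′ x
      classify′ x with classify I x
      ... | inj₂ (inj₁ settled) = inj₂ (inj₁ (settled-preserved A ¬deg-u ¬deg-w settled))
      ... | inj₂ (inj₂ (inj₁ x∈s)) = inj₂ (place-s x∈s)
      ... | inj₂ (inj₂ (inj₂ x∈t)) = inj₂ (place-t x∈t)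
      ... | inj₁ iso with x ≟ u | x ≟ w
      ...   | yes refl | _ = inj₂ place-u
      ...   | no _ | yes refl = inj₂ place-w
      ...   | no x≢u | no x≢w = inj₁ (isolated-preserved A iso (x≢u , x≢w))

    layout-newPath : ∀ {s} → Layout G s noPath → Isolated G u → Isolated G w → u ≢ w → Layout G′ s (path₂ u w)
    layout-newPath {s} I iso-u iso-w u≢w =
      layout-step I u≢w (isolated⇒¬degree≡2 iso-u) (isolated⇒¬degree≡2 iso-w)
        (pathComponent-preserved A s (component₁ I) λ x∈s → ≢isolated iso-u x∈s , ≢isolated iso-w x∈s)
        (isolated-extended A iso-u , isolated-extended (flip-added A) iso-w)
        (λ x∈s → λ { ∈₀ → ≢isolated iso-u x∈s refl ; ∈₁ → ≢isolated iso-w x∈s refl })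
        (inj₂ ∘ inj₁) (λ ()) (inj₂ (inj₂ ∈₀)) (inj₂ (inj₂ ∈₁))
      where
      ≢isolated : ∀ {z} → Isolated G z → ∀ {x} → x ∈ vertices s → x ≢ z
      ≢isolated iso x∈s refl = isolated∉path s (component₁ I) iso x∈s

    layout-extend : ∀ {s s′} → Layout G s noPath → vertices s′ ≡ vertices s List.++ w ∷ [] →
                    PathComponent G′ s′ → u ∈ vertices s → ¬ Degree≡2 G u → Isolated G w → Layout G′ s′ noPath
    layout-extend {s} I s′≡s+w component u∈s ¬deg-u iso-w =
      layout-step I u≢w ¬deg-u (isolated⇒¬degree≡2 iso-w) component _ (λ _ ())
        (inj₂ ∘ inj₁ ∘ grown ∘ Any.++⁺ˡ) (λ ()) (inj₂ (inj₁ (grown (Any.++⁺ˡ u∈s))))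
        (inj₂ (inj₁ (grown (Any.++⁺ʳ (vertices s) ∈₀))))
      where
      grown : ∀ {x} → x ∈ vertices s List.++ w ∷ [] → x ∈ _
      grown = subst (_ ∈_) (sym s′≡s+w)
      u≢w : u ≢ w
      u≢w refl = isolated∉path s (component₁ I) iso-w u∈s

    layout-close : ∀ {s t} → Layout G s t → u ∈ vertices s → w ∈ vertices s → u ≢ w →
                   ¬ Degree≡2 G u → ¬ Degree≡2 G w → (∀ {y} → y ∈ vertices s → Inner G′ (vertices s) y) →
                   Layout G′ noPath t
    layout-close {s} {t} I u∈s w∈s u≢w ¬deg-u ¬deg-w cycle =
      layout-step I u≢w ¬deg-u ¬deg-w _
        (pathComponent-preserved A t (component₂ I)
          λ x∈t → (λ { refl → disjoint I u∈s x∈t }) , (λ { refl → disjoint I w∈s x∈t }))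
        (λ ()) settle (inj₂ ∘ inj₂) (settle u∈s) (settle w∈s)
      where
      settle : ∀ {x} → x ∈ vertices s → Placed G′ noPath t x
      settle x∈s = inj₁ (vertices s , length-vertices≤5 s , x∈s , cycle)

    layout-join : ∀ {a y} → Layout G (path₂ a u) (path₂ w y) → Layout G′ (path₄ a u w y) noPath
    layout-join {a} {y} I with component₁ I | component₂ I
    ... | a-u@(a∼u , _) , u-a | w-y , y-w@(y∼w , _) =
      layout-step I (disjoint I ∈₁ ∘ here) (neighbours₁⇒¬degree≡2 u-a) (neighbours₁⇒¬degree≡2 w-y)
        ( neighbours₁-preserved A a-u (∼⇒≢ (loopless I) a∼u , a≢w)
        , neighbours₁-extended A u-a a≢w
        , neighbours₂-swap (neighbours₁-extended (flip-added A) w-y y≢u)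
        , neighbours₁-preserved A y-w (y≢u , ∼⇒≢ (loopless I) y∼w) )
        _ (λ _ ()) (inj₂ ∘ inj₁ ∘ Any.++⁺ˡ) (inj₂ ∘ inj₁ ∘ Any.++⁺ʳ (a ∷ u ∷ []))
        (inj₂ (inj₁ ∈₁)) (inj₂ (inj₁ ∈₂))
      where
      a≢w : a ≢ w
      a≢w refl = disjoint I ∈₀ ∈₀
      y≢u : y ≢ u
      y≢u refl = disjoint I ∈₁ ∈₁

    layout-extend₂ : ∀ {a} → Layout G (path₂ a u) noPath → Isolated G w → Layout G′ (path₃ a u w) noPath
    layout-extend₂ I iso-w with component₁ I
    ... | a-u@(a∼u , _) , u-a =
      layout-extend I refl
        ( neighbours₁-preserved A a-u (∼⇒≢ (loopless I) a∼u , ∼⇒≢isolated a∼u iso-w)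
        , neighbours₁-extended A u-a (∼⇒≢isolated a∼u iso-w)
        , isolated-extended (flip-added A) iso-w )
        ∈₁ (neighbours₁⇒¬degree≡2 u-a) iso-w

    layout-extend₃ : ∀ {a b} → Layout G (path₃ a b u) noPath → Isolated G w → Layout G′ (path₄ a b u w) noPath
    layout-extend₃ I iso-w with component₁ I
    ... | a-b@(a∼b , _) , b-au@(a≢u , b∼a , b∼u , _) , u-b =
      layout-extend I refl
        ( neighbours₁-preserved A a-b (a≢u , ∼⇒≢isolated a∼b iso-w)
        , neighbours₂-preserved A b-au (∼⇒≢ (loopless I) b∼u , ∼⇒≢isolated b∼a iso-w)
        , neighbours₁-extended A u-b (∼⇒≢isolated b∼a iso-w)
        , isolated-extended (flip-added A) iso-w )
        ∈₂ (neighbours₁⇒¬degree≡2 u-b) iso-w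

    layout-extend₄ : ∀ {a b c} → Layout G (path₄ a b c u) noPath → Isolated G w →
                     Layout G′ (path₅ a b c u w) noPath
    layout-extend₄ I iso-w with component₁ I
    ... | a-b@(a∼b , _) , b-ac@(a≢c , b∼a , b∼c , _) , c-bu@(_ , c∼b , c∼u , _) , u-c@(_ , only-c) =
      layout-extend I refl
        ( neighbours₁-preserved A a-b ((λ { refl → ∼⇒≢ (loopless I) b∼c (only-c a∼b) }) ,
                                         ∼⇒≢isolated a∼b iso-w)
        , neighbours₂-preserved A b-ac ((λ { refl → a≢c (only-c b∼a) }) , ∼⇒≢isolated b∼a iso-w)
        , neighbours₂-preserved A c-bu (∼⇒≢ (loopless I) c∼u , ∼⇒≢isolated c∼b iso-w)
        , neighbours₁-extended A u-c (∼⇒≢isolated c∼b iso-w)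
        , isolated-extended (flip-added A) iso-w )
        ∈₃ (neighbours₁⇒¬degree≡2 u-c) iso-w

    layout-close₃ : ∀ {b t} → Layout G (path₃ u b w) t → Layout G′ noPath t
    layout-close₃ I with component₁ I
    ... | u-b , b-uw@(u≢w , b∼u , b∼w , _) , w-b =
      layout-close I ∈₀ ∈₂ u≢w (neighbours₁⇒¬degree≡2 u-b) (neighbours₁⇒¬degree≡2 w-b) λ where
        ∈₀ → _ , _ , ∈₁ , ∈₂ , neighbours₁-extended A u-b b≢w
        ∈₁ → _ , _ , ∈₀ , ∈₂ , neighbours₂-preserved A b-uw (b≢u , b≢w)
        ∈₂ → _ , _ , ∈₁ , ∈₀ , neighbours₁-extended (flip-added A) w-b b≢u
      where
      b≢u = ∼⇒≢ (loopless I) b∼u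
      b≢w = ∼⇒≢ (loopless I) b∼w

    layout-close₄ : ∀ {b c t} → Layout G (path₄ u b c w) t → Layout G′ noPath t
    layout-close₄ I with component₁ I
    ... | u-b , b-uc@(u≢c , b∼u , _) , c-bw@(b≢w , _ , c∼w , _) , w-c =
      layout-close I ∈₀ ∈₃ (proj₁ (ends-apart₄ (loopless I) (component₁ I)))
        (neighbours₁⇒¬degree≡2 u-b) (neighbours₁⇒¬degree≡2 w-c) λ where
        ∈₀ → _ , _ , ∈₁ , ∈₃ , neighbours₁-extended A u-b b≢w
        ∈₁ → _ , _ , ∈₀ , ∈₂ , neighbours₂-preserved A b-uc (b≢u , b≢w)
        ∈₂ → _ , _ , ∈₁ , ∈₃ , neighbours₂-preserved A c-bw (u≢c ∘ sym , c≢w)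
        ∈₃ → _ , _ , ∈₂ , ∈₀ , neighbours₁-extended (flip-added A) w-c (u≢c ∘ sym)
      where
      b≢u = ∼⇒≢ (loopless I) b∼u
      c≢w = ∼⇒≢ (loopless I) c∼w

    layout-close₅ : ∀ {b c d t} → Layout G (path₅ u b c d w) t → Layout G′ noPath t
    layout-close₅ {b} {c} {d} I with component₁ I
    ... | u-b@(_ , only-b) , b-uc@(u≢c , b∼u , b∼c , _) , c-bd@(_ , c∼b , _) , d-cw@(c≢w , d∼c , d∼w , _)
        , w-d@(_ , only-d) =
      layout-close I ∈₀ ∈₄ (proj₁ (ends-apart₅ (loopless I) (component₁ I)))
        (neighbours₁⇒¬degree≡2 u-b) (neighbours₁⇒¬degree≡2 w-d) λ where
        ∈₀ → _ , _ , ∈₁ , ∈₄ , neighbours₁-extended A u-b b≢w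
        ∈₁ → _ , _ , ∈₀ , ∈₂ , neighbours₂-preserved A b-uc (b≢u , b≢w)
        ∈₂ → _ , _ , ∈₁ , ∈₃ , neighbours₂-preserved A c-bd (u≢c ∘ sym , c≢w)
        ∈₃ → _ , _ , ∈₂ , ∈₄ , neighbours₂-preserved A d-cw (d≢u , d≢w)
        ∈₄ → _ , _ , ∈₃ , ∈₀ , neighbours₁-extended (flip-added A) w-d d≢u
      where
      b≢u = ∼⇒≢ (loopless I) b∼u
      d≢w = ∼⇒≢ (loopless I) d∼w
      b≢w : b ≢ w
      b≢w refl = u≢c (trans (only-d b∼u) (sym (only-d b∼c)))
      d≢u : d ≢ u
      d≢u refl = ∼⇒≢ (loopless I) c∼b (only-b d∼c)

  data Short : PathShape → Set where
    short₀ : Short noPath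
    short₂ : ∀ {a b} → Short (path₂ a b)
    short₃ : ∀ {a b c} → Short (path₃ a b c)
    short₄ : ∀ {a b c d} → Short (path₄ a b c d)

  MaxTurn : Graph n → Set
  MaxTurn G = ∃ λ s → Short s × Layout G s noPath

  Reply : Graph n → Set
  Reply G = ∃ λ e → e ∈ legalMoves S₄ G × MaxTurn (addEdge G e)

  MiniTurn : Graph n → Set
  MiniTurn G = (∃ λ s → ∃ λ t → Layout G s t) × (∀ {e} → e ∈ legalMoves S₄ G → Reply G)

  reply-ordered : ∀ {G u w} → toℕ u < toℕ w → ¬ u ∼[ G ] w → MaxTurn (addEdge G (u , w)) → Reply G
  reply-ordered u<w ¬u∼w next@(_ , _ , I) = _ , legalMove⁺ {F = S₄} u<w ¬u∼w (layout-S₄-free I) , next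

  claim : ∀ {G u w} → Symmetric G → u ≢ w → ¬ u ∼[ G ] w → (∀ {G′} → EdgeAdded G G′ u w → MaxTurn G′) →
          Reply G
  claim {G} {u} {w} sym-G u≢w ¬u∼w next with <-cmp (toℕ u) (toℕ w)
  ... | tri< u<w _ _ = reply-ordered u<w ¬u∼w (next (addEdge-added G u w))
  ... | tri≈ _ u≡w _ = contradiction (toℕ-injective u≡w) u≢w
  ... | tri> _ _ w<u = reply-ordered w<u (¬u∼w ∘ sym-G) (next (flip-added (addEdge-added G w u)))

  legalMove-endpoints : ∀ {G s t u w} → Layout G s t → (u , w) ∈ legalMoves S₄ G →
                        u ≢ w × ¬ u ∼[ G ] w × ¬ Degree≡2 G u × ¬ Degree≡2 G w
  legalMove-endpoints {G} {u = u} {w} I uw∈ with legalMove⁻ {F = S₄} uw∈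
  ... | u≢w , ¬u∼w , S₄-free =
    u≢w , ¬u∼w , S₄-free⇒¬degree≡2 A (loopless I) u≢w ¬u∼w S₄-free ,
    S₄-free⇒¬degree≡2 (flip-added A) (loopless I) (u≢w ∘ sym) (¬u∼w ∘ symmetric I) S₄-free
    where A = addEdge-added G u w

  reply-start : ∀ {G} → Layout G noPath noPath → ∀ {e} → e ∈ legalMoves S₄ G → Reply G
  reply-start {G} I {u , w} uw∈ with legalMove-endpoints I uw∈
  ... | u≢w , _ , ¬deg-u , ¬deg-w with classify-¬degree≡2 I ¬deg-u | classify-¬degree≡2 I ¬deg-w
  ... | inj₁ iso-u | inj₁ iso-w =
    (u , w) , uw∈ , _ , short₂ , layout-swap (layout-newPath (addEdge-added G u w) I iso-u iso-w u≢w)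

  legalMove-isolated : ∀ {G a b} → Layout G (path₂ a b) noPath → ∀ {e} → e ∈ legalMoves S₄ G →
                       ∃ (Isolated G)
  legalMove-isolated I e∈ with legalMove-endpoints I e∈
  ... | u≢w , ¬u∼w , ¬deg-u , ¬deg-w with classify-¬degree≡2 I ¬deg-u | classify-¬degree≡2 I ¬deg-w
  ... | inj₁ iso-u | _ = _ , iso-u
  ... | inj₂ _ | inj₁ iso-w = _ , iso-w
  ... | inj₂ u∈s | inj₂ w∈s = contradiction (path₂-adjacent (component₁ I) u∈s w∈s u≢w) ¬u∼w

  reply-extend₂ : ∀ {G a b} → Layout G (path₂ a b) noPath → ∀ {e} → e ∈ legalMoves S₄ G → Reply G
  reply-extend₂ I e∈ with legalMove-isolated I e∈ | component₁ I
  ... | z , iso-z | _ , (b∼a , _) =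
    claim (symmetric I) (∼⇒≢isolated b∼a iso-z) (iso-z ∘ symmetric I)
      λ A → _ , short₃ , layout-extend₂ A I iso-z

  reply-join : ∀ {G a b x y} → Layout G (path₂ a b) (path₂ x y) → Reply G
  reply-join I with component₁ I
  ... | _ , (_ , only-a) =
    claim (symmetric I) (λ { refl → disjoint I ∈₁ ∈₀ }) (λ b∼x → disjoint I (here (only-a b∼x)) ∈₀)
      λ A → _ , short₄ , layout-join A I

  reply-close₃ : ∀ {G a b c t} → Layout G (path₃ a b c) t → Short t → Reply G
  reply-close₃ I short-t with ends-apart₃ (loopless I) (component₁ I)
  ... | a≢c , ¬a∼c = claim (symmetric I) a≢c ¬a∼c λ A → _ , short-t , layout-swap (layout-close₃ A I)

  reply-close₄ : ∀ {G a b c d t} → Layout G (path₄ a b c d) t → Short t → Reply G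
  reply-close₄ I short-t with ends-apart₄ (loopless I) (component₁ I)
  ... | a≢d , ¬a∼d = claim (symmetric I) a≢d ¬a∼d λ A → _ , short-t , layout-swap (layout-close₄ A I)

  reply-close₅ : ∀ {G a b c d e t} → Layout G (path₅ a b c d e) t → Short t → Reply G
  reply-close₅ I short-t with ends-apart₅ (loopless I) (component₁ I)
  ... | a≢e , ¬a∼e = claim (symmetric I) a≢e ¬a∼e λ A → _ , short-t , layout-swap (layout-close₅ A I)

  miniStarts : ∀ {G} → Layout G noPath noPath → MiniTurn G
  miniStarts I = (_ , _ , I) , reply-start I

  miniCloses₃ : ∀ {G a b c t} → Layout G (path₃ a b c) t → Short t → MiniTurn G
  miniCloses₃ I short-t = (_ , _ , I) , λ _ → reply-close₃ I short-t

  miniCloses₄ : ∀ {G a b c d t} → Layout G (path₄ a b c d) t → Short t → MiniTurn G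
  miniCloses₄ I short-t = (_ , _ , I) , λ _ → reply-close₄ I short-t

  miniCloses₅ : ∀ {G a b c d e t} → Layout G (path₅ a b c d e) t → Short t → MiniTurn G
  miniCloses₅ I short-t = (_ , _ , I) , λ _ → reply-close₅ I short-t

  module _ {G G′ : Graph n} {u w : Fin n} (A : EdgeAdded G G′ u w) where

    maxExtends₂ : ∀ {a b} → Layout G (path₂ a b) noPath → u ∈ vertices (path₂ a b) → Isolated G w →
                  MiniTurn G′
    maxExtends₂ I ∈₀ iso-w = miniCloses₃ (layout-extend₂ A (layout-reverse I) iso-w) short₀
    maxExtends₂ I ∈₁ iso-w = miniCloses₃ (layout-extend₂ A I iso-w) short₀

    maxExtends₃ : ∀ {a b c} → Layout G (path₃ a b c) noPath → u ≡ a ⊎ u ≡ c → Isolated G w → MiniTurn G′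
    maxExtends₃ I (inj₁ refl) iso-w = miniCloses₄ (layout-extend₃ A (layout-reverse I) iso-w) short₀
    maxExtends₃ I (inj₂ refl) iso-w = miniCloses₄ (layout-extend₃ A I iso-w) short₀

    maxExtends₄ : ∀ {a b c d} → Layout G (path₄ a b c d) noPath → u ≡ a ⊎ u ≡ d → Isolated G w →
                  MiniTurn G′
    maxExtends₄ I (inj₁ refl) iso-w = miniCloses₅ (layout-extend₄ A (layout-reverse I) iso-w) short₀
    maxExtends₄ I (inj₂ refl) iso-w = miniCloses₅ (layout-extend₄ A I iso-w) short₀

    maxCloses₃ : ∀ {a b c} → Layout G (path₃ a b c) noPath →
                 u ≡ a ⊎ u ≡ c → w ≡ a ⊎ w ≡ c → u ≢ w → MiniTurn G′
    maxCloses₃ I (inj₁ refl) (inj₂ refl) _ = miniStarts (layout-close₃ A I)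
    maxCloses₃ I (inj₂ refl) (inj₁ refl) _ = miniStarts (layout-close₃ A (layout-reverse I))
    maxCloses₃ I (inj₁ refl) (inj₁ refl) u≢w = contradiction refl u≢w
    maxCloses₃ I (inj₂ refl) (inj₂ refl) u≢w = contradiction refl u≢w

    maxCloses₄ : ∀ {a b c d} → Layout G (path₄ a b c d) noPath →
                 u ≡ a ⊎ u ≡ d → w ≡ a ⊎ w ≡ d → u ≢ w → MiniTurn G′
    maxCloses₄ I (inj₁ refl) (inj₂ refl) _ = miniStarts (layout-close₄ A I)
    maxCloses₄ I (inj₂ refl) (inj₁ refl) _ = miniStarts (layout-close₄ A (layout-reverse I))
    maxCloses₄ I (inj₁ refl) (inj₁ refl) u≢w = contradiction refl u≢w
    maxCloses₄ I (inj₂ refl) (inj₂ refl) u≢w = contradiction refl u≢w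

  MiniCanAnswer : PathShape → Set
  MiniCanAnswer s = ∀ {G G′ u w} → Layout G s noPath → EdgeAdded G G′ u w →
                    u ≢ w → ¬ u ∼[ G ] w → ¬ Degree≡2 G u → ¬ Degree≡2 G w → MiniTurn G′

  answer₀ : MiniCanAnswer noPath
  answer₀ I A u≢w _ ¬deg-u ¬deg-w with classify-¬degree≡2 I ¬deg-u | classify-¬degree≡2 I ¬deg-w
  ... | inj₁ iso-u | inj₁ iso-w = (_ , _ , I′) , reply-extend₂ I′
    where I′ = layout-swap (layout-newPath A I iso-u iso-w u≢w)

  answer₂ : ∀ {a b} → MiniCanAnswer (path₂ a b)
  answer₂ I A u≢w ¬u∼w ¬deg-u ¬deg-w with classify-¬degree≡2 I ¬deg-u | classify-¬degree≡2 I ¬deg-w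
  ... | inj₁ iso-u | inj₁ iso-w = (_ , _ , I′) , λ _ → reply-join I′
    where I′ = layout-newPath A I iso-u iso-w u≢w
  ... | inj₂ u∈s | inj₁ iso-w = maxExtends₂ A I u∈s iso-w
  ... | inj₁ iso-u | inj₂ w∈s = maxExtends₂ (flip-added A) I w∈s iso-u
  ... | inj₂ u∈s | inj₂ w∈s = contradiction (path₂-adjacent (component₁ I) u∈s w∈s u≢w) ¬u∼w

  answer₃ : ∀ {a b c} → MiniCanAnswer (path₃ a b c)
  answer₃ I A u≢w _ ¬deg-u ¬deg-w with classify-¬degree≡2 I ¬deg-u | classify-¬degree≡2 I ¬deg-w
  ... | inj₁ iso-u | inj₁ iso-w = miniCloses₃ (layout-newPath A I iso-u iso-w u≢w) short₂
  ... | inj₂ u∈s | inj₁ iso-w = maxExtends₃ A I (ends₃ (component₁ I) u∈s ¬deg-u) iso-w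
  ... | inj₁ iso-u | inj₂ w∈s = maxExtends₃ (flip-added A) I (ends₃ (component₁ I) w∈s ¬deg-w) iso-u
  ... | inj₂ u∈s | inj₂ w∈s =
    maxCloses₃ A I (ends₃ (component₁ I) u∈s ¬deg-u) (ends₃ (component₁ I) w∈s ¬deg-w) u≢w

  answer₄ : ∀ {a b c d} → MiniCanAnswer (path₄ a b c d)
  answer₄ I A u≢w _ ¬deg-u ¬deg-w with classify-¬degree≡2 I ¬deg-u | classify-¬degree≡2 I ¬deg-w
  ... | inj₁ iso-u | inj₁ iso-w = miniCloses₄ (layout-newPath A I iso-u iso-w u≢w) short₂
  ... | inj₂ u∈s | inj₁ iso-w = maxExtends₄ A I (ends₄ (component₁ I) u∈s ¬deg-u) iso-w
  ... | inj₁ iso-u | inj₂ w∈s = maxExtends₄ (flip-added A) I (ends₄ (component₁ I) w∈s ¬deg-w) iso-u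
  ... | inj₂ u∈s | inj₂ w∈s =
    maxCloses₄ A I (ends₄ (component₁ I) u∈s ¬deg-u) (ends₄ (component₁ I) w∈s ¬deg-w) u≢w

  answer : ∀ {s} → Short s → MiniCanAnswer s
  answer short₀ = answer₀
  answer short₂ = answer₂
  answer short₃ = answer₃
  answer short₄ = answer₄

  P₆-strategy : MiniStrategy {n} P₆ S₄ 0
  P₆-strategy = record
    { MaxTurn = MaxTurn
    ; MiniTurn = MiniTurn
    ; maxTurn-score = λ (_ , _ , I) → ≤-reflexive (layout-#copies I)
    ; miniTurn-score = λ ((_ , _ , I) , _) → ≤-reflexive (layout-#copies I)
    ; maxTurn-move = move
    ; miniTurn-reply = λ t → proj₂ t }
    where
    move : ∀ {G e} → MaxTurn G → e ∈ legalMoves S₄ G → MiniTurn (addEdge G e)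
    move {G} {u , w} (_ , short , I) uw∈ with legalMove-endpoints I uw∈
    ... | u≢w , ¬u∼w , ¬deg-u , ¬deg-w = answer short I (addEdge-added G u w) u≢w ¬u∼w ¬deg-u ¬deg-w

theorem1p4 : (n : ℕ) → n ≥ 1 → (s₁ n P₆ S₄ ≡ 0) × (s₂ n P₆ S₄ ≡ 0)
theorem1p4 n _ =
  n≤0⇒n≡0 (value-Max≤ σ fuel (noPath , short₀ , layout-empty)) ,
  n≤0⇒n≡0 (value-Mini≤ σ fuel (miniStarts layout-empty))
  where
  σ = P₆-strategy {n}
  fuel = length (edgesKn n)
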